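{- For every integer $n\ge2$, the Möbius ladder $M_{2n}$ admits no extended irregular dominating set.
   Context: For $n\ge2$, the Möbius ladder $M_{2n}$ has vertex set $\{x_1,\dots,x_{2n}\}$ and edge set $\{\{x_i,x_{i+1}\}:1\le i\le 2n\}\cup\{\{x_i,x_{i+n}\}:1\le i\le n\}$, subscripts modulo $2n$. For a graph $\Gamma=(V,E)$ with distance $d$: a vertex $v$ carrying a positive integer label $\ell$ dominates exactly the vertices $u$ with $d(u,v)=\ell$; a vertex carrying label $0$ dominates only itself. An extended irregular dominating set is a set $S\subseteq V$ together with an injective labeling $\lambda:S\to\{0,1,2,\dots\}$ such that every vertex of $V$ is dominated by some vertex of $S$, where some vertex of $S$ has label $0$. -}

module Defs where

open import Data.Nat using (ℕ; zero; suc; _+_; _<_)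
open import Data.Fin using (Fin; toℕ)
open import Data.Fin.Subset using (Subset; _∈_)
open import Data.Product using (Σ; _×_; ∃-syntax)
open import Data.Sum using (_⊎_)
open import Relation.Binary.PropositionalEquality using (_≡_)
open import Relation.Nullary using (¬_)

-- Vertices of M_{2n}: Fin (n + n); vertex x_i (1 ≤ i ≤ 2n) is the Fin element i-1.

-- Directed version of the edge set:
--   cycle edge  {x_i, x_{i+1}}  (indices mod 2n), 0-indexed: j = i+1, or i = 2n-1 and j = 0
--   rung        {x_i, x_{i+n}}  for 1 ≤ i ≤ n, 0-indexed: j = i + n
EdgeDir : (n : ℕ) → Fin (n + n) → Fin (n + n) → Set
EdgeDir n i j =
  (toℕ j ≡ suc (toℕ i))
  ⊎ ((suc (toℕ i) ≡ n + n) × (toℕ j ≡ 0))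
  ⊎ (toℕ j ≡ toℕ i + n)

Adj : (n : ℕ) → Fin (n + n) → Fin (n + n) → Set
Adj n u v = EdgeDir n u v ⊎ EdgeDir n v u

data Walk (n : ℕ) : ℕ → Fin (n + n) → Fin (n + n) → Set where
  nil  : ∀ {u} → Walk n 0 u u
  cons : ∀ {k u w v} → Adj n u w → Walk n k w v → Walk n (suc k) u v

Dist : (n : ℕ) → Fin (n + n) → Fin (n + n) → ℕ → Set
Dist n u v k = Walk n k u v × (∀ m → m < k → ¬ Walk n m u v)

Dominates : (n : ℕ) → ℕ → Fin (n + n) → Fin (n + n) → Set
Dominates n zero      v u = u ≡ v
Dominates n (suc ℓ)   v u = Dist n u v (suc ℓ)

-- Extended irregular dominating set: S with labelling λ (only its values on S matter)
-- injective on S, every vertex dominated by some vertex of S, some vertex of S labelled 0.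
IsExtIrrDomSet : (n : ℕ) → Subset (n + n) → (Fin (n + n) → ℕ) → Set
IsExtIrrDomSet n S lab =
  (∀ v w → v ∈ S → w ∈ S → lab v ≡ lab w → v ≡ w)
  × (∀ u → ∃[ v ] (v ∈ S × Dominates n (lab v) v u))
  × (∃[ v ] (v ∈ S × lab v ≡ 0))

module Submission where

-- Identify x_(i+1) with i ∈ ℤ/2n; the edges join i to i ± 1 and i + n, so the distance of
-- u from v depends only on δ = u − v: if k ≤ n is the distance of δ on the 2n-cycle, it is
-- min(k, n + 1 − k).  In an irregular dominating set every vertex u lies on the sphere of
-- radius λ(c) about its dominator c; since the labels are distinct, u ↦ u − c is injective,
-- hence a bijection of ℤ/2n, so these spheres are pairwise disjoint and every distance
-- occurs as a label.  Let v be the centre with label d(n − 1) ≥ 1 and c ≠ v its dominator.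
-- Shifting v by n − 1 or by n + 1 gives a vertex at distance d(n − 1) from v and at
-- distance d(v, c) = λ(c) from c, which lies on two spheres at once.

open import Defs
open import Data.Nat using (ℕ; zero; suc; _+_; _∸_; _⊓_; _≤_; _<_; NonZero; z≤n; s≤s; _≤?_; _<?_)
open import Data.Nat.Properties
open import Data.Nat.DivMod
  using (_%_; m%n<n; m<n⇒m%n≡m; [m+n]%n≡m%n; %-distribˡ-+; m%n%n≡m%n; n%n≡0)
open import Data.Nat.Tactic.RingSolver using (solve-∀)
open import Data.Fin using (Fin; toℕ; fromℕ<; punchOut)
open import Data.Fin.Properties
  using (toℕ-fromℕ<; toℕ-injective; toℕ<n; any?; punchOut-injective; injective⇒≤)
  renaming (_≟_ to _≟ᶠ_)
open import Data.Fin.Subset using (Subset; _∈_)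
open import Data.Product using (Σ; _×_; _,_; proj₁; proj₂; ∃-syntax)
open import Data.Sum using (inj₁; inj₂; [_,_]′)
open import Data.Empty using (⊥)
open import Function using (_∘_)
open import Function.Definitions using (Injective; StrictlySurjective)
open import Relation.Nullary using (¬_; yes; no; contradiction)
open import Relation.Binary.PropositionalEquality

injective⇒strictlySurjective : ∀ {k} {f : Fin k → Fin k} →
                               Injective _≡_ _≡_ f → StrictlySurjective _≡_ f
injective⇒strictlySurjective {zero}  _     ()
injective⇒strictlySurjective {suc k} {f} f-injective y with any? (λ x → f x ≟ᶠ y)
... | yes hit  = hit
... | no  miss = contradiction (injective⇒≤ punchOut∘f-injective) 1+n≰n
  where
    y≢f : ∀ x → y ≢ f x
    y≢f x y≡fx = miss (x , sym y≡fx)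

    punchOut∘f-injective : Injective _≡_ _≡_ (λ x → punchOut (y≢f x))
    punchOut∘f-injective eq = f-injective (punchOut-injective (y≢f _) (y≢f _) eq)

m∸n≤suc[m∸suc[n]] : ∀ m n → m ∸ n ≤ suc (m ∸ suc n)
m∸n≤suc[m∸suc[n]] zero    zero    = z≤n
m∸n≤suc[m∸suc[n]] zero    (suc n) = z≤n
m∸n≤suc[m∸suc[n]] (suc m) zero    = ≤-refl
m∸n≤suc[m∸suc[n]] (suc m) (suc n) = m∸n≤suc[m∸suc[n]] m n

WithinOne : ℕ → ℕ → Set
WithinOne a b = a ≤ suc b × b ≤ suc a

withinOne-sym : ∀ {a b} → WithinOne a b → WithinOne b a
withinOne-sym (a≤ , b≤) = b≤ , a≤

withinOne-suc : ∀ a → WithinOne a (suc a)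
withinOne-suc a = ≤-trans (n≤1+n a) (n≤1+n (suc a)) , ≤-refl

⊓-withinOne : ∀ {a b c d} → WithinOne a b → WithinOne c d → WithinOne (a ⊓ c) (b ⊓ d)
-- suc x ⊓ suc y reduces to suc (x ⊓ y).
⊓-withinOne (a≤ , b≤) (c≤ , d≤) = ⊓-mono-≤ a≤ c≤ , ⊓-mono-≤ b≤ d≤

∸-withinOne : ∀ k {a b} → WithinOne a b → WithinOne (k ∸ a) (k ∸ b)
∸-withinOne k {a} {b} (a≤ , b≤) =
  ≤-trans (m∸n≤suc[m∸suc[n]] k a) (s≤s (∸-monoʳ-≤ k b≤)) ,
  ≤-trans (m∸n≤suc[m∸suc[n]] k b) (s≤s (∸-monoʳ-≤ k a≤))

⊓-suc-withinOne : ∀ a b → WithinOne (a ⊓ suc b) (b ⊓ suc a)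
⊓-suc-withinOne a b = bound a b , bound b a
  where
    bound : ∀ a b → a ⊓ suc b ≤ suc (b ⊓ suc a)
    bound a b = ≤-trans (≤-reflexive (⊓-comm a (suc b)))
                        (⊓-monoʳ-≤ (suc b) (≤-trans (n≤1+n a) (n≤1+n (suc a))))

module Cyclic (N : ℕ) {{_ : NonZero N}} where

  [x%N+y]%N≡[x+y]%N : ∀ x y → (x % N + y) % N ≡ (x + y) % N
  [x%N+y]%N≡[x+y]%N x y = begin
    (x % N + y) % N          ≡⟨ %-distribˡ-+ (x % N) y N ⟩
    (x % N % N + y % N) % N  ≡⟨ cong (λ z → (z + y % N) % N) (m%n%n≡m%n x N) ⟩
    (x % N + y % N) % N      ≡⟨ sym (%-distribˡ-+ x y N) ⟩
    (x + y) % N              ∎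
    where open ≡-Reasoning

  [x+y%N]%N≡[x+y]%N : ∀ x y → (x + y % N) % N ≡ (x + y) % N
  [x+y%N]%N≡[x+y]%N x y = begin
    (x + y % N) % N  ≡⟨ cong (_% N) (+-comm x (y % N)) ⟩
    (y % N + x) % N  ≡⟨ [x%N+y]%N≡[x+y]%N y x ⟩
    (y + x) % N      ≡⟨ cong (_% N) (+-comm y x) ⟩
    (x + y) % N      ∎
    where open ≡-Reasoning

  toℕ%N : ∀ (u : Fin N) → toℕ u % N ≡ toℕ u
  toℕ%N u = m<n⇒m%n≡m (toℕ<n u)

  infixl 6 _⊕_ _⊖_

  _⊕_ : Fin N → ℕ → Fin N
  u ⊕ t = fromℕ< (m%n<n (toℕ u + t) N)

  _⊖_ : Fin N → Fin N → Fin N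
  u ⊖ v = u ⊕ (N ∸ toℕ v)

  toℕ-⊕ : ∀ u t → toℕ (u ⊕ t) ≡ (toℕ u + t) % N
  toℕ-⊕ u t = toℕ-fromℕ< _

  ⊕-≡ : ∀ u t {w} → (toℕ u + t) % N ≡ toℕ w → u ⊕ t ≡ w
  ⊕-≡ u t eq = toℕ-injective (trans (toℕ-⊕ u t) eq)

  ⊕-≡-toℕ : ∀ u t {w} → toℕ u + t ≡ toℕ w → u ⊕ t ≡ w
  ⊕-≡-toℕ u t {w} eq = ⊕-≡ u t (trans (cong (_% N) eq) (toℕ%N w))

  ⊕-⊕ : ∀ u s t → u ⊕ s ⊕ t ≡ u ⊕ (s + t)
  ⊕-⊕ u s t = ⊕-≡ (u ⊕ s) t (begin
    (toℕ (u ⊕ s) + t) % N      ≡⟨ cong (λ z → (z + t) % N) (toℕ-⊕ u s) ⟩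
    ((toℕ u + s) % N + t) % N  ≡⟨ [x%N+y]%N≡[x+y]%N (toℕ u + s) t ⟩
    (toℕ u + s + t) % N        ≡⟨ cong (_% N) (+-assoc (toℕ u) s t) ⟩
    (toℕ u + (s + t)) % N      ≡⟨ sym (toℕ-⊕ u (s + t)) ⟩
    toℕ (u ⊕ (s + t))          ∎)
    where open ≡-Reasoning

  ⊕-identityʳ : ∀ u → u ⊕ 0 ≡ u
  ⊕-identityʳ u = ⊕-≡-toℕ u 0 (+-identityʳ (toℕ u))

  ⊕-N : ∀ u → u ⊕ N ≡ u
  ⊕-N u = ⊕-≡ u N (trans ([m+n]%n≡m%n (toℕ u) N) (toℕ%N u))

  ⊕-∸ : ∀ u {t} → t ≤ N → u ⊕ t ⊕ (N ∸ t) ≡ u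
  ⊕-∸ u {t} t≤N = trans (⊕-⊕ u t (N ∸ t)) (trans (cong (u ⊕_) (m+[n∸m]≡n t≤N)) (⊕-N u))

  ⊕-⊖ : ∀ u v → v ⊕ toℕ (u ⊖ v) ≡ u
  ⊕-⊖ u v = ⊕-≡ v (toℕ (u ⊖ v)) (begin
    (toℕ v + toℕ (u ⊖ v)) % N                ≡⟨ cong (λ z → (toℕ v + z) % N) (toℕ-⊕ u (N ∸ toℕ v)) ⟩
    (toℕ v + (toℕ u + (N ∸ toℕ v)) % N) % N  ≡⟨ [x+y%N]%N≡[x+y]%N (toℕ v) _ ⟩
    (toℕ v + (toℕ u + (N ∸ toℕ v))) % N      ≡⟨ cong (_% N) (x+[y+z]≡y+[x+z] (toℕ v) (toℕ u) _) ⟩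
    (toℕ u + (toℕ v + (N ∸ toℕ v))) % N      ≡⟨ cong (λ z → (toℕ u + z) % N) (m+[n∸m]≡n (<⇒≤ (toℕ<n v))) ⟩
    (toℕ u + N) % N                          ≡⟨ [m+n]%n≡m%n (toℕ u) N ⟩
    toℕ u % N                                ≡⟨ toℕ%N u ⟩
    toℕ u                                    ∎)
    where
      open ≡-Reasoning
      x+[y+z]≡y+[x+z] : ∀ x y z → x + (y + z) ≡ y + (x + z)
      x+[y+z]≡y+[x+z] = solve-∀

  ⊖-cancelʳ : ∀ {u u' v} → u ⊖ v ≡ u' ⊖ v → u ≡ u'
  ⊖-cancelʳ {u} {u'} {v} eq =
    trans (sym (⊕-⊖ u v)) (trans (cong (λ x → v ⊕ toℕ x) eq) (⊕-⊖ u' v))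

  ⊖≡0⇒≡ : ∀ {u v} → toℕ (u ⊖ v) ≡ 0 → u ≡ v
  ⊖≡0⇒≡ {u} {v} eq = trans (sym (⊕-⊖ u v)) (trans (cong (v ⊕_) eq) (⊕-identityʳ v))

  toℕ-⊖-self : ∀ v → toℕ (v ⊖ v) ≡ 0
  toℕ-⊖-self v =
    trans (toℕ-⊕ v (N ∸ toℕ v)) (trans (cong (_% N) (m+[n∸m]≡n (<⇒≤ (toℕ<n v)))) (n%n≡0 N))

  toℕ-⊕-⊖ : ∀ u t v → toℕ (u ⊕ t ⊖ v) ≡ (toℕ (u ⊖ v) + t) % N
  toℕ-⊕-⊖ u t v = begin
    toℕ (u ⊕ t ⊕ (N ∸ toℕ v))    ≡⟨ cong toℕ (⊕-⊕ u t (N ∸ toℕ v)) ⟩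
    toℕ (u ⊕ (t + (N ∸ toℕ v)))  ≡⟨ cong (toℕ ∘ (u ⊕_)) (+-comm t (N ∸ toℕ v)) ⟩
    toℕ (u ⊕ (N ∸ toℕ v + t))    ≡⟨ cong toℕ (sym (⊕-⊕ u (N ∸ toℕ v) t)) ⟩
    toℕ (u ⊖ v ⊕ t)              ≡⟨ toℕ-⊕ (u ⊖ v) t ⟩
    (toℕ (u ⊖ v) + t) % N        ∎
    where open ≡-Reasoning

  toℕ-⊕-⊖-self : ∀ v {t} → t < N → toℕ (v ⊕ t ⊖ v) ≡ t
  toℕ-⊕-⊖-self v {t} t<N =
    trans (toℕ-⊕-⊖ v t v) (trans (cong (λ z → (z + t) % N) (toℕ-⊖-self v)) (m<n⇒m%n≡m t<N))

-- Around a centre c lies the sphere {x | d (x ⊖ c) ≡ lab c}, d being the distance as a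
-- function of the offset.  Distinct labels make u ↦ u ⊖ owner u injective, hence bijective.
module SphereTiling
  {N : ℕ} (_⊖_ : Fin N → Fin N → Fin N)
  (⊖-cancelʳ : ∀ {u u' v} → u ⊖ v ≡ u' ⊖ v → u ≡ u')
  (d : Fin N → ℕ)
  {Center : Fin N → Set} {lab : Fin N → ℕ}
  (lab-injective : ∀ c c' → Center c → Center c' → lab c ≡ lab c' → c ≡ c')
  (dominator : ∀ u → ∃[ c ] Center c × d (u ⊖ c) ≡ lab c)
  where

  owner : Fin N → Fin N
  owner u = proj₁ (dominator u)

  owner-center : ∀ u → Center (owner u)
  owner-center u = proj₁ (proj₂ (dominator u))

  owner-dominates : ∀ u → d (u ⊖ owner u) ≡ lab (owner u)
  owner-dominates u = proj₂ (proj₂ (dominator u))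

  owner-by-position : ∀ {u x c} → Center c → d (x ⊖ c) ≡ lab c →
                      u ⊖ owner u ≡ x ⊖ c → owner u ≡ c
  owner-by-position {u} {c = c} c-center x∈c same =
    lab-injective (owner u) c (owner-center u) c-center
      (trans (sym (owner-dominates u)) (trans (cong d same) x∈c))

  position-injective : Injective _≡_ _≡_ (λ u → u ⊖ owner u)
  position-injective {u} {u'} same =
    ⊖-cancelʳ (trans same (cong (u' ⊖_) (sym owner≡owner')))
    where
      owner≡owner' : owner u ≡ owner u'
      owner≡owner' = owner-by-position (owner-center u') (owner-dominates u') same

  position-surjective : StrictlySurjective _≡_ (λ u → u ⊖ owner u)
  position-surjective = injective⇒strictlySurjective position-injective

  owner-unique : ∀ {x c} → Center c → d (x ⊖ c) ≡ lab c → owner x ≡ c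
  owner-unique {x} {c} c-center x∈c = from-position (position-surjective (x ⊖ c))
    where
      from-position : ∃[ u ] u ⊖ owner u ≡ x ⊖ c → owner x ≡ c
      from-position (u , same) = subst (λ y → owner y ≡ c) u≡x owner≡c
        where
          owner≡c : owner u ≡ c
          owner≡c = owner-by-position c-center x∈c same

          u≡x : u ≡ x
          u≡x = ⊖-cancelʳ (trans (cong (u ⊖_) (sym owner≡c)) same)

  sphere-unique : ∀ {x c c'} → Center c → Center c' →
                  d (x ⊖ c) ≡ lab c → d (x ⊖ c') ≡ lab c' → c ≡ c'
  sphere-unique c-center c'-center x∈c x∈c' =
    trans (sym (owner-unique c-center x∈c)) (owner-unique c'-center x∈c')

  distance-realised : ∀ δ → ∃[ c ] Center c × lab c ≡ d δ
  distance-realised δ with u , same ← position-surjective δ =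
    owner u , owner-center u , trans (sym (owner-dominates u)) (cong d same)

module MöbiusLadder (m : ℕ) where

  n N : ℕ
  n = suc m
  N = n + n

  open Cyclic N public

  N∸n≡n : N ∸ n ≡ n
  N∸n≡n = m+n∸n≡m n n

  cycleDist : ℕ → ℕ
  cycleDist δ = δ ⊓ (N ∸ δ)

  -- Crossing a rung turns cycle distance k into n ∸ k, so it reaches k in suc n ∸ k steps.
  shortcut : ℕ → ℕ
  shortcut k = k ⊓ (suc n ∸ k)

  ladderDist : ℕ → ℕ
  ladderDist δ = shortcut (cycleDist δ)

  cycleDist-≤n : ∀ {δ} → δ ≤ n → cycleDist δ ≡ δ
  cycleDist-≤n {δ} δ≤n = m≤n⇒m⊓n≡m (≤-trans δ≤n (subst (_≤ N ∸ δ) N∸n≡n (∸-monoʳ-≤ N δ≤n)))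

  cycleDist-≥n : ∀ {δ} → n ≤ δ → cycleDist δ ≡ N ∸ δ
  cycleDist-≥n {δ} n≤δ = m≥n⇒m⊓n≡n (≤-trans (subst (N ∸ δ ≤_) N∸n≡n (∸-monoʳ-≤ N n≤δ)) n≤δ)

  cycleDist≤n : ∀ δ → cycleDist δ ≤ n
  cycleDist≤n δ with δ ≤? n
  ... | yes δ≤n = ≤-trans (m⊓n≤m δ (N ∸ δ)) δ≤n
  ... | no  δ≰n =
    ≤-trans (m⊓n≤n δ (N ∸ δ)) (subst (N ∸ δ ≤_) N∸n≡n (∸-monoʳ-≤ N (<⇒≤ (≰⇒> δ≰n))))

  [n+e+n]%N≡e : ∀ {e} → e < n → (n + e + n) % N ≡ e
  [n+e+n]%N≡e {e} e<n = begin
    (n + e + n) % N    ≡⟨ cong (_% N) (+-comm (n + e) n) ⟩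
    (n + (n + e)) % N  ≡⟨ cong (_% N) (sym (+-assoc n n e)) ⟩
    (N + e) % N        ≡⟨ cong (_% N) (+-comm N e) ⟩
    (e + N) % N        ≡⟨ [m+n]%n≡m%n e N ⟩
    e % N              ≡⟨ m<n⇒m%n≡m (<-≤-trans e<n (m≤m+n n n)) ⟩
    e                  ∎
    where open ≡-Reasoning

  cycleDist-rung : ∀ {δ} → δ < N → cycleDist ((δ + n) % N) ≡ n ∸ cycleDist δ
  cycleDist-rung {δ} δ<N with δ <? n
  ... | yes δ<n = begin
    cycleDist ((δ + n) % N)  ≡⟨ cong cycleDist (m<n⇒m%n≡m (+-monoˡ-< n δ<n)) ⟩
    cycleDist (δ + n)        ≡⟨ cycleDist-≥n (m≤n+m n δ) ⟩
    N ∸ (δ + n)              ≡⟨ cong (N ∸_) (+-comm δ n) ⟩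
    N ∸ (n + δ)              ≡⟨ [m+n]∸[m+o]≡n∸o n n δ ⟩
    n ∸ δ                    ≡⟨ cong (n ∸_) (sym (cycleDist-≤n (<⇒≤ δ<n))) ⟩
    n ∸ cycleDist δ          ∎
    where open ≡-Reasoning
  ... | no δ≮n with e , refl ← m≤n⇒∃[o]m+o≡n {n} {δ} (≮⇒≥ δ≮n) = begin
    cycleDist ((n + e + n) % N)  ≡⟨ cong cycleDist ([n+e+n]%N≡e e<n) ⟩
    cycleDist e                  ≡⟨ cycleDist-≤n (<⇒≤ e<n) ⟩
    e                            ≡⟨ sym (m∸[m∸n]≡n (<⇒≤ e<n)) ⟩
    n ∸ (n ∸ e)                  ≡⟨ cong (n ∸_) (sym ([m+n]∸[m+o]≡n∸o n n e)) ⟩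
    n ∸ (N ∸ (n + e))            ≡⟨ cong (n ∸_) (sym (cycleDist-≥n (m≤m+n n e))) ⟩
    n ∸ cycleDist (n + e)        ∎
    where
      open ≡-Reasoning
      e<n : e < n
      e<n = +-cancelˡ-< n e n δ<N

  cycleDist-step : ∀ {δ} → δ < N → WithinOne (cycleDist δ) (cycleDist ((δ + 1) % N))
  cycleDist-step {δ} δ<N with suc δ <? N
  ... | yes sδ<N = subst (WithinOne (cycleDist δ) ∘ cycleDist) (sym δ+1%N≡sδ)
    (⊓-withinOne (withinOne-suc δ) (∸-withinOne N (withinOne-suc δ)))
    where
      δ+1%N≡sδ : (δ + 1) % N ≡ suc δ
      δ+1%N≡sδ = trans (cong (_% N) (+-comm δ 1)) (m<n⇒m%n≡m sδ<N)
  ... | no  sδ≮N = subst (WithinOne (cycleDist δ) ∘ cycleDist) (sym δ+1%N≡0) (cycleDist-δ≤1 , z≤n)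
    where
      sδ≡N : suc δ ≡ N
      sδ≡N = ≤-antisym δ<N (≮⇒≥ sδ≮N)

      δ+1%N≡0 : (δ + 1) % N ≡ 0
      δ+1%N≡0 = trans (cong (_% N) (trans (+-comm δ 1) sδ≡N)) (n%n≡0 N)

      cycleDist-δ≤1 : cycleDist δ ≤ 1
      cycleDist-δ≤1 =
        ≤-trans (m⊓n≤n δ (N ∸ δ)) (≤-reflexive (trans (cong (_∸ δ) (sym sδ≡N)) (m+n∸n≡m 1 δ)))

  shortcut-withinOne : ∀ {a b} → WithinOne a b → WithinOne (shortcut a) (shortcut b)
  shortcut-withinOne a≈b = ⊓-withinOne a≈b (∸-withinOne (suc n) a≈b)

  shortcut-rung : ∀ {k} → k ≤ n → WithinOne (shortcut k) (shortcut (n ∸ k))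
  shortcut-rung {k} k≤n = subst₂ WithinOne (sym via-k) (sym via-n∸k) (⊓-suc-withinOne k (n ∸ k))
    where
      via-k : shortcut k ≡ k ⊓ suc (n ∸ k)
      via-k = cong (k ⊓_) (+-∸-assoc 1 k≤n)

      via-n∸k : shortcut (n ∸ k) ≡ (n ∸ k) ⊓ suc k
      via-n∸k = cong ((n ∸ k) ⊓_) (trans (+-∸-assoc 1 (m∸n≤m n k)) (cong suc (m∸[m∸n]≡n k≤n)))

  shortcut-mirror : ∀ {k} → k ≤ suc n → shortcut (suc n ∸ k) ≡ shortcut k
  shortcut-mirror {k} k≤sn = trans (cong ((suc n ∸ k) ⊓_) (m∸[m∸n]≡n k≤sn)) (⊓-comm (suc n ∸ k) k)

  data Move : ℕ → Set where
    rim  : Move 1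
    rung : Move n

  ladderDist-move : ∀ {t δ} → Move t → δ < N → WithinOne (ladderDist δ) (ladderDist ((δ + t) % N))
  ladderDist-move rim  δ<N = shortcut-withinOne (cycleDist-step δ<N)
  ladderDist-move {δ = δ} rung δ<N =
    subst (WithinOne (ladderDist δ) ∘ shortcut) (sym (cycleDist-rung δ<N))
      (shortcut-rung (cycleDist≤n δ))

  edge⇒move : ∀ {u w} → EdgeDir n u w → ∃[ t ] Move t × w ≡ u ⊕ t
  edge⇒move {u} (inj₁ w≡su) =
    1 , rim , sym (⊕-≡-toℕ u 1 (trans (+-comm (toℕ u) 1) (sym w≡su)))
  edge⇒move {u} (inj₂ (inj₁ (su≡N , w≡0))) =
    1 , rim , sym (⊕-≡ u 1 (trans (cong (_% N) (trans (+-comm (toℕ u) 1) su≡N))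
                                   (trans (n%n≡0 N) (sym w≡0))))
  edge⇒move {u} (inj₂ (inj₂ w≡u+n)) =
    n , rung , sym (⊕-≡-toℕ u n (sym w≡u+n))

  ladderDist-⊕ : ∀ {t} x v → Move t →
                 WithinOne (ladderDist (toℕ (x ⊖ v))) (ladderDist (toℕ (x ⊕ t ⊖ v)))
  ladderDist-⊕ {t} x v move =
    subst (WithinOne _ ∘ ladderDist) (sym (toℕ-⊕-⊖ x t v)) (ladderDist-move move (toℕ<n (x ⊖ v)))

  adj⇒ladderDist-withinOne : ∀ {u w} v → Adj n u w →
                             WithinOne (ladderDist (toℕ (u ⊖ v))) (ladderDist (toℕ (w ⊖ v)))
  adj⇒ladderDist-withinOne {u} v (inj₁ u→w) with _ , move , refl ← edge⇒move u→w =
    ladderDist-⊕ u v move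
  adj⇒ladderDist-withinOne {w = w} v (inj₂ w→u) with _ , move , refl ← edge⇒move w→u =
    withinOne-sym (ladderDist-⊕ w v move)

  ladderDist≤length : ∀ {k u v} → Walk n k u v → ladderDist (toℕ (u ⊖ v)) ≤ k
  ladderDist≤length {u = u} nil = ≤-reflexive (cong ladderDist (toℕ-⊖-self u))
  ladderDist≤length {v = v} (cons u~w walk) =
    ≤-trans (proj₁ (adj⇒ladderDist-withinOne v u~w)) (s≤s (ladderDist≤length walk))

  adj-⊕1 : ∀ u → Adj n u (u ⊕ 1)
  adj-⊕1 u with suc (toℕ u) <? N
  ... | yes su<N =
    inj₁ (inj₁ (trans (toℕ-⊕ u 1) (trans (cong (_% N) (+-comm (toℕ u) 1)) (m<n⇒m%n≡m su<N))))
  ... | no  su≮N =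
    inj₁ (inj₂ (inj₁ (su≡N , trans (toℕ-⊕ u 1) (trans (cong (_% N) (trans (+-comm (toℕ u) 1) su≡N)) (n%n≡0 N)))))
    where
      su≡N : suc (toℕ u) ≡ N
      su≡N = ≤-antisym (toℕ<n u) (≮⇒≥ su≮N)

  adj-⊕n : ∀ u → Adj n u (u ⊕ n)
  adj-⊕n u with toℕ u <? n
  ... | yes u<n = inj₁ (inj₂ (inj₂ (trans (toℕ-⊕ u n) (m<n⇒m%n≡m (+-monoˡ-< n u<n)))))
  ... | no  u≮n with e , n+e≡u ← m≤n⇒∃[o]m+o≡n {n} {toℕ u} (≮⇒≥ u≮n) =
    inj₂ (inj₂ (inj₂ (sym (begin
    toℕ (u ⊕ n) + n      ≡⟨ cong (_+ n) (toℕ-⊕ u n) ⟩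
    (toℕ u + n) % N + n  ≡⟨ cong (λ z → (z + n) % N + n) (sym n+e≡u) ⟩
    (n + e + n) % N + n  ≡⟨ cong (_+ n) ([n+e+n]%N≡e e<n) ⟩
    e + n                ≡⟨ +-comm e n ⟩
    n + e                ≡⟨ n+e≡u ⟩
    toℕ u                ∎))))
    where
      open ≡-Reasoning
      e<n : e < n
      e<n = +-cancelˡ-< n e n (subst (_< N) (sym n+e≡u) (toℕ<n u))

  walk-⊕ : ∀ j u → Walk n j u (u ⊕ j)
  walk-⊕ zero    u = subst (Walk n 0 u) (sym (⊕-identityʳ u)) nil
  walk-⊕ (suc j) u = cons (adj-⊕1 u) (subst (Walk n j (u ⊕ 1)) (⊕-⊕ u 1 j) (walk-⊕ j (u ⊕ 1)))

  adj-sym : ∀ {u v} → Adj n u v → Adj n v u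
  adj-sym (inj₁ u→v) = inj₂ u→v
  adj-sym (inj₂ v→u) = inj₁ v→u

  walk-snoc : ∀ {k u v w} → Walk n k u v → Adj n v w → Walk n (suc k) u w
  walk-snoc nil          v~w = cons v~w nil
  walk-snoc (cons u~x p) v~w = cons u~x (walk-snoc p v~w)

  walk-reverse : ∀ {k u v} → Walk n k u v → Walk n k v u
  walk-reverse nil          = nil
  walk-reverse (cons u~w p) = walk-snoc (walk-reverse p) (adj-sym u~w)

  rim-walk : ∀ u v → Walk n (cycleDist (toℕ (u ⊖ v))) u v
  rim-walk u v = [ from-v , from-u ]′ (⊓-sel δ (N ∸ δ))
    where
      δ : ℕ
      δ = toℕ (u ⊖ v)

      u⊕[N∸δ]≡v : u ⊕ (N ∸ δ) ≡ v
      u⊕[N∸δ]≡v = subst (λ x → x ⊕ (N ∸ δ) ≡ v) (⊕-⊖ u v) (⊕-∸ v (<⇒≤ (toℕ<n (u ⊖ v))))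

      from-v : cycleDist δ ≡ δ → Walk n (cycleDist δ) u v
      from-v c≡δ = subst₂ (λ k x → Walk n k x v) (sym c≡δ) (⊕-⊖ u v) (walk-reverse (walk-⊕ δ v))

      from-u : cycleDist δ ≡ N ∸ δ → Walk n (cycleDist δ) u v
      from-u c≡N∸δ = subst₂ (λ k x → Walk n k u x) (sym c≡N∸δ) u⊕[N∸δ]≡v (walk-⊕ (N ∸ δ) u)

  shortest-walk : ∀ u v → Walk n (ladderDist (toℕ (u ⊖ v))) u v
  shortest-walk u v = [ around , across ]′ (⊓-sel (cycleDist δ) (suc n ∸ cycleDist δ))
    where
      δ : ℕ
      δ = toℕ (u ⊖ v)

      rung-first-length : suc (cycleDist (toℕ (u ⊕ n ⊖ v))) ≡ suc n ∸ cycleDist δ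
      rung-first-length = begin
        suc (cycleDist (toℕ (u ⊕ n ⊖ v)))  ≡⟨ cong (suc ∘ cycleDist) (toℕ-⊕-⊖ u n v) ⟩
        suc (cycleDist ((δ + n) % N))      ≡⟨ cong suc (cycleDist-rung (toℕ<n (u ⊖ v))) ⟩
        suc (n ∸ cycleDist δ)              ≡⟨ sym (+-∸-assoc 1 (cycleDist≤n δ)) ⟩
        suc n ∸ cycleDist δ                ∎
        where open ≡-Reasoning

      around : ladderDist δ ≡ cycleDist δ → Walk n (ladderDist δ) u v
      around eq = subst (λ k → Walk n k u v) (sym eq) (rim-walk u v)

      across : ladderDist δ ≡ suc n ∸ cycleDist δ → Walk n (ladderDist δ) u v
      across eq = subst (λ k → Walk n k u v) (trans rung-first-length (sym eq))
                    (cons (adj-⊕n u) (rim-walk (u ⊕ n) v))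

  Dist⇒ladderDist : ∀ {u v k} → Dist n u v k → k ≡ ladderDist (toℕ (u ⊖ v))
  Dist⇒ladderDist {u} {v} (walk , no-shorter) =
    ≤-antisym (≮⇒≥ (λ shorter → no-shorter _ shorter (shortest-walk u v))) (ladderDist≤length walk)

  Dominates⇒ladderDist : ∀ ℓ c u → Dominates n ℓ c u → ladderDist (toℕ (u ⊖ c)) ≡ ℓ
  Dominates⇒ladderDist zero    c u refl        = cong ladderDist (toℕ-⊖-self u)
  Dominates⇒ladderDist (suc ℓ) c u u-at-dist-ℓ = sym (Dist⇒ladderDist u-at-dist-ℓ)

  m<N : m < N
  m<N = s≤s (m≤m+n m n)

  ladderDist-m-positive : 1 ≤ m → 1 ≤ ladderDist m
  ladderDist-m-positive 1≤m = subst (1 ≤_) (cong shortcut (sym (cycleDist-≤n (n≤1+n m))))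
    (⊓-glb 1≤m (m<n⇒0<n∸m (m<n⇒m<1+n (n<1+n m))))

  ladderDist-suc-n : ladderDist (suc n) ≡ ladderDist m
  ladderDist-suc-n = cong shortcut (begin
    cycleDist (suc n)  ≡⟨ cycleDist-≥n (n≤1+n n) ⟩
    N ∸ suc n          ≡⟨ m+n∸n≡m m n ⟩
    m                  ≡⟨ sym (cycleDist-≤n (n≤1+n m)) ⟩
    cycleDist m        ∎)
    where open ≡-Reasoning

  cycleDist-+m : ∀ {δ} → 1 ≤ δ → δ ≤ n → cycleDist ((δ + m) % N) ≡ suc n ∸ cycleDist δ
  cycleDist-+m {suc e} _ (s≤s e≤m) = begin
    cycleDist ((suc e + m) % N)  ≡⟨ cong cycleDist (m<n⇒m%n≡m sum<N) ⟩
    cycleDist (suc e + m)        ≡⟨ cycleDist-≥n (s≤s (m≤n+m m e)) ⟩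
    N ∸ (suc e + m)              ≡⟨ cong (m + n ∸_) (+-comm e m) ⟩
    m + n ∸ (m + e)              ≡⟨ [m+n]∸[m+o]≡n∸o m n e ⟩
    suc n ∸ suc e                ≡⟨ cong (suc n ∸_) (sym (cycleDist-≤n (s≤s e≤m))) ⟩
    suc n ∸ cycleDist (suc e)    ∎
    where
      open ≡-Reasoning
      sum<N : suc e + m < N
      sum<N = s≤s (subst (suc (e + m) ≤_) (sym (+-suc m m)) (s≤s (+-monoˡ-≤ m e≤m)))

  cycleDist-+suc-n : ∀ {δ} → n < δ → δ < N → cycleDist ((δ + suc n) % N) ≡ suc n ∸ cycleDist δ
  cycleDist-+suc-n {δ} n<δ δ<N with e , refl ← m≤n⇒∃[o]m+o≡n {suc n} {δ} n<δ = begin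
    cycleDist ((suc n + e + suc n) % N)  ≡⟨ cong (cycleDist ∘ (_% N)) (wrap m e) ⟩
    cycleDist ((suc (suc e) + N) % N)    ≡⟨ cong cycleDist ([m+n]%n≡m%n (suc (suc e)) N) ⟩
    cycleDist (suc (suc e) % N)          ≡⟨ cong cycleDist (m<n⇒m%n≡m (s≤s (≤-trans (s≤s e<m) (m≤n+m n m)))) ⟩
    cycleDist (suc (suc e))              ≡⟨ cycleDist-≤n (s≤s e<m) ⟩
    suc (suc e)                          ≡⟨ cong (suc ∘ suc) (sym (m∸[m∸n]≡n (<⇒≤ e<m))) ⟩
    suc (suc (m ∸ (m ∸ e)))              ≡⟨ sym (+-∸-assoc 2 (m∸n≤m m e)) ⟩
    suc n ∸ (m ∸ e)                      ≡⟨ cong (suc n ∸_) (sym N∸δ≡m∸e) ⟩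
    suc n ∸ (N ∸ (suc n + e))            ≡⟨ cong (suc n ∸_) (sym (cycleDist-≥n (≤-trans (n≤1+n n) (m≤m+n (suc n) e)))) ⟩
    suc n ∸ cycleDist (suc n + e)        ∎
    where
      open ≡-Reasoning
      wrap : ∀ m e → suc (suc m) + e + suc (suc m) ≡ suc (suc e) + (suc m + suc m)
      wrap = solve-∀

      e<m : e < m
      e<m = +-cancelˡ-< m e m (≤-pred (subst (suc (suc (m + e)) ≤_) (+-suc m m) (≤-pred δ<N)))

      N∸δ≡m∸e : N ∸ (suc n + e) ≡ m ∸ e
      N∸δ≡m∸e = trans (cong (N ∸_) (cong suc (sym (+-suc m e)))) ([m+n]∸[m+o]≡n∸o n n (suc e))

  ladderDist-mirror : ∀ {x δ} → cycleDist x ≡ suc n ∸ cycleDist δ → ladderDist x ≡ ladderDist δ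
  ladderDist-mirror {δ = δ} eq =
    trans (cong shortcut eq) (shortcut-mirror (≤-trans (cycleDist≤n δ) (n≤1+n n)))

  -- Shifting by m if δ ≤ n, and by suc n otherwise, turns the cycle distance k of δ into
  -- suc n ∸ k, which shortcut does not distinguish from k.
  distance-preserving-shift : 1 ≤ m → ∀ {δ} → 1 ≤ δ → δ < N →
    ∃[ t ] t < N × ladderDist t ≡ ladderDist m × ladderDist ((δ + t) % N) ≡ ladderDist δ
  distance-preserving-shift 1≤m {δ} 1≤δ δ<N with δ ≤? n
  ... | yes δ≤n = m , m<N , refl , ladderDist-mirror (cycleDist-+m 1≤δ δ≤n)
  ... | no  δ≰n =
    suc n , s≤s (+-monoˡ-≤ n 1≤m) , ladderDist-suc-n , ladderDist-mirror (cycleDist-+suc-n (≰⇒> δ≰n) δ<N)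

  spheres-meet : 1 ≤ m → ∀ {v c} → v ≢ c →
    ∃[ w ] ladderDist (toℕ (w ⊖ v)) ≡ ladderDist m
         × ladderDist (toℕ (w ⊖ c)) ≡ ladderDist (toℕ (v ⊖ c))
  spheres-meet 1≤m {v} {c} v≢c
    with t , t<N , at-m , preserved ← distance-preserving-shift 1≤m (n≢0⇒n>0 (v≢c ∘ ⊖≡0⇒≡)) (toℕ<n (v ⊖ c)) =
    v ⊕ t , trans (cong ladderDist (toℕ-⊕-⊖-self v t<N)) at-m
          , trans (cong ladderDist (toℕ-⊕-⊖ v t c)) preserved

  module _ {Center : Fin N → Set} {lab : Fin N → ℕ}
           (lab-injective : ∀ c c' → Center c → Center c' → lab c ≡ lab c' → c ≡ c')
           (dominator : ∀ u → ∃[ c ] Center c × ladderDist (toℕ (u ⊖ c)) ≡ lab c)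
           where

    open SphereTiling _⊖_ (λ {u u' v} → ⊖-cancelʳ {u} {u'} {v}) (ladderDist ∘ toℕ)
                      lab-injective dominator

    center-of-radius-m : ∃[ v ] Center v × lab v ≡ ladderDist m
    center-of-radius-m with v , v-center , lab-v ← distance-realised (fromℕ< m<N) =
      v , v-center , trans lab-v (cong ladderDist (toℕ-fromℕ< m<N))

    center-of-radius-m-undominated : 1 ≤ m → ∀ {v c} → Center v → lab v ≡ ladderDist m →
                                     Center c → ladderDist (toℕ (v ⊖ c)) ≡ lab c → ⊥
    center-of-radius-m-undominated 1≤m {v} {c} v-center lab-v c-center v∈sphere-c = v≢c (v≡c v≢c)
      where
        v≢c : v ≢ c
        v≢c refl = <⇒≢ (ladderDist-m-positive 1≤m)
          (sym (trans (sym lab-v) (trans (sym v∈sphere-c) (cong ladderDist (toℕ-⊖-self v)))))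

        v≡c : v ≢ c → v ≡ c
        v≡c v≢c =
          let w , w∈sphere-v , w∈sphere-c = spheres-meet 1≤m v≢c
          in sphere-unique {w} v-center c-center
               (trans w∈sphere-v (sym lab-v)) (trans w∈sphere-c v∈sphere-c)

    no-sphere-tiling : 1 ≤ m → ⊥
    no-sphere-tiling 1≤m =
      let v , v-center , lab-v      = center-of-radius-m
          c , c-center , v∈sphere-c = dominator v
      in center-of-radius-m-undominated 1≤m v-center lab-v c-center v∈sphere-c

theorem3p6 : (n : ℕ) → 2 ≤ n →
    ¬ Σ (Subset (n + n)) (λ S → Σ (Fin (n + n) → ℕ) (λ lab → IsExtIrrDomSet n S lab))
-- The label 0 is not assumed: distance-realised produces it.
theorem3p6 (suc m) (s≤s 1≤m) (S , lab , lab-injective , dominated , _) =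
  no-sphere-tiling lab-injective dominator 1≤m
  where
    open MöbiusLadder m

    dominator : ∀ u → ∃[ c ] c ∈ S × ladderDist (toℕ (u ⊖ c)) ≡ lab c
    dominator u = let c , c∈S , c-dominates-u = dominated u
                  in c , c∈S , Dominates⇒ladderDist (lab c) c u c-dominates-u
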